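{- Let $r \geq 5$ be an integer. Let $x_r = r$ and for $i = r-1, r-2, \ldots, 1$ define $$x_i = x_{i+1} - 1 + \left\lfloor \frac{x_{i+1}-1}{i}\right\rfloor = \left\lfloor \frac{(i+1)(x_{i+1}-1)}{i}\right\rfloor.$$ Then there are only two positive integers, namely $x_1$ and $x_1 - 1$, whose strange root is $r$ if and only if $x_{i+1} - 1 \not\equiv 0 \pmod{i}$ for all $i \in \{2,\ldots,r-2\}$.
   Context: For $n \in \{1,2,\ldots\}$, $\mathsf{Alist}_n$ is the sequence of integer pairs produced as follows: begin with $\langle 1, n\rangle$. Given the current pair $\langle i, y_i\rangle$ with $y_i > i$, the next pair is $\langle i+1, y_{i+1}\rangle$, where $y_{i+1}$ is the smallest integer with $(i+1)y_{i+1} > i(y_i+1)$. Stop when the current pair $\langle i,y_i\rangle$ satisfies $y_i \leq i$. This process always terminates; its final pair is denoted $\langle \mathsf{sr}(n), y_{\mathsf{sr}(n)}\rangle$, and $\mathsf{sr}(n)$ is called the strange root of $n$. -}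

module Defs where

open import Data.Nat using (ℕ; zero; suc; _+_; _*_; _∸_; _≤_; _<_)
open import Data.Nat.DivMod using (_/_)
open import Data.Product using (∃; _×_)

-- Transition of Alist: from ⟨i, y⟩ (with y > i) the next second
-- coordinate is z, the smallest integer with (i+1) z > i (y+1).
-- (Such z is necessarily positive, so ℕ loses nothing.)
Next : ℕ → ℕ → ℕ → Set
Next i y z = (i * (y + 1) < suc i * z) × (∀ w → i * (y + 1) < suc i * w → z ≤ w)

-- Reach n i y : the pair ⟨i, y⟩ occurs in Alist_n.
data Reach (n : ℕ) : ℕ → ℕ → Set where
  start : Reach n 1 n
  step  : ∀ {i y z} → Reach n i y → i < y → Next i y z → Reach n (suc i) z

-- Strange root: the process stops at the first pair ⟨i, y⟩ with y ≤ i,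
-- so sr(n) = r iff some pair ⟨r, y⟩ with y ≤ r occurs in Alist_n.
SR : ℕ → ℕ → Set
SR n r = ∃ λ y → Reach n r y × y ≤ r

_div_ : ℕ → ℕ → ℕ
m div zero = 0
m div suc j = m / suc j

-- xsFrom r k = x_{r-k}:  x_r = r,  x_i = ⌊(i+1)(x_{i+1} - 1) / i⌋
xsFrom : ℕ → ℕ → ℕ
xsFrom r zero = r
xsFrom r (suc k) = (suc i * (xsFrom r k ∸ 1)) div i
  where i = r ∸ suc k

-- x r i = x_i (meaningful for 1 ≤ i ≤ r)
x : ℕ → ℕ → ℕ
x r i = xsFrom r (r ∸ i)

-- x_j = ⌊(j + 1)(x_{j+1} − 1)/j⌋ says exactly that x_{j+1} follows x_j in an Alist, so the
-- list started at x₁ runs through the pairs ⟨j, x_j⟩ and stops at ⟨r, r⟩. The step is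
-- monotone, so a start above x₁ stays strictly above every x_j and never stops at r.
-- A list one below x_j moves one below x_{j+1}, except that it rejoins x_{j+1} exactly when
-- j ∣ x_{j+1} − 1. This always happens at j = 1, so x₁ − 1 has strange root r as well, while
-- x₁ − 2 lands one below x₂. From there a divisor i ∈ [2, r − 2] puts x₁ − 2 back on track;
-- with no divisor every start n ≤ x₁ − 2 stays below the x_j and, as x_{r−1} = r, stops at
-- r − 1.
module Submission where

open import Defs
open import Data.Nat
  using (ℕ; zero; suc; _+_; _*_; _∸_; _≤_; _<_; z≤n; s≤s; s≤s⁻¹; _≟_; NonZero; >-nonZero)
open import Data.Nat.Properties
open import Data.Nat.DivMod using (_/_; _%_; m≡m%n+[m/n]*n; m%n<n; m/n*n≤m)
open import Data.Nat.Divisibility using (_∣_; divides; 1∣_; ∣n⇒∣m*n; m∣m*n; ∣m+n∣m⇒∣n)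
open import Data.Product using (_×_; _,_; ∃)
open import Data.Sum using (_⊎_; inj₁; inj₂)
open import Relation.Nullary using (¬_; yes; no; contradiction)
open import Relation.Binary.PropositionalEquality
  using (_≡_; _≢_; refl; sym; trans; cong; subst; subst₂)
open import Function.Bundles using (_⇔_; mk⇔; Equivalence)

≤-induction : (P : ℕ → Set) {a b : ℕ} →
              (∀ {k} → a ≤ k → k < b → P k → P (suc k)) → P a → a ≤ b → P b
≤-induction P {b = zero} _ base z≤n = base
≤-induction P {b = suc b} up base a≤1+b with m≤n⇒m<n∨m≡n a≤1+b
... | inj₂ refl = base
... | inj₁ a<1+b =
  up a≤b ≤-refl (≤-induction P (λ a≤k k<b → up a≤k (m<n⇒m<1+n k<b)) base a≤b)
  where a≤b = s≤s⁻¹ a<1+b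

suc[m∸1]≡m : ∀ {m} → 1 ≤ m → suc (m ∸ 1) ≡ m
suc[m∸1]≡m (s≤s _) = refl

m∸2≢m-or-m∸1 : ∀ {m} → 2 ≤ m → ¬ (m ∸ 2 ≡ m ⊎ m ∸ 2 ≡ m ∸ 1)
m∸2≢m-or-m∸1 {suc zero} (s≤s ())
m∸2≢m-or-m∸1 {suc (suc m)} _ (inj₁ eq) = <-irrefl eq (s≤s (n≤1+n m))
m∸2≢m-or-m∸1 {suc (suc m)} _ (inj₂ eq) = <-irrefl eq ≤-refl

n≤m≤1+n⇒n≡m⊎n≡m∸1 : ∀ {n m} → n ≤ m → m ≤ suc n → n ≡ m ⊎ n ≡ m ∸ 1
n≤m≤1+n⇒n≡m⊎n≡m∸1 n≤m m≤1+n with m≤n⇒m<n∨m≡n n≤m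
... | inj₂ n≡m = inj₁ n≡m
... | inj₁ n<m = inj₂ (cong (_∸ 1) (≤-antisym n<m m≤1+n))

infix 4 ⌊_/_⌋≡_

record ⌊_/_⌋≡_ (m d q : ℕ) : Set where
  constructor _,_
  field
    lower : d * q ≤ m
    upper : m < d * suc q

⌊/⌋≡div : ∀ m {d} → 1 ≤ d → ⌊ m / d ⌋≡ (m div d)
⌊/⌋≡div m {suc d} _ = subst (_≤ m) (*-comm q (suc d)) (m/n*n≤m m (suc d)) , m<d*[1+q]
  where
  q = m / suc d
  m<d*[1+q] : m < suc d * suc q
  m<d*[1+q] = begin-strict
    m                     ≡⟨ m≡m%n+[m/n]*n m (suc d) ⟩
    m % suc d + q * suc d <⟨ +-monoˡ-< (q * suc d) (m%n<n m (suc d)) ⟩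
    suc d + q * suc d     ≡⟨ cong (suc d +_) (*-comm q (suc d)) ⟩
    suc d + suc d * q     ≡⟨ *-suc (suc d) q ⟨
    suc d * suc q         ∎
    where open ≤-Reasoning

⌊/⌋≡-exact : ∀ {m d q} .{{_ : NonZero d}} → ⌊ m / d ⌋≡ q → d ∣ m → d * q ≡ m
⌊/⌋≡-exact {d = d} {q} (lo , hi) (divides k refl) = trans (cong (d *_) q≡k) (*-comm d k)
  where
  q≡k : q ≡ k
  q≡k = ≤-antisym (*-cancelˡ-≤ d (subst (d * q ≤_) (*-comm k d) lo))
                  (s≤s⁻¹ (*-cancelˡ-< d _ _ (subst (_< d * suc q) (*-comm k d) hi)))

*≡suc*⇒∣ : ∀ {d q X} → d * q ≡ suc d * X → d ∣ X
*≡suc*⇒∣ {d} {q} {X} eq =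
  ∣m+n∣m⇒∣n (subst (d ∣_) (trans eq (+-comm X (d * X))) (m∣m*n q)) (m∣m*n X)

*[+1]≡*suc : ∀ j y → j * (y + 1) ≡ j * suc y
*[+1]≡*suc j y = cong (j *_) (+-comm y 1)

next-lower : ∀ {j y z} → Next j y z → j * suc y < suc j * z
next-lower {j} {y} {z} (lower , _) = subst (_< suc j * z) (*[+1]≡*suc j y) lower

next-least : ∀ {j y z w} → Next j y z → j * suc y < suc j * w → z ≤ w
next-least {j} {y} {w = w} (_ , least) h =
  least w (subst (_< suc j * w) (sym (*[+1]≡*suc j y)) h)

mkNext : ∀ {j y z} → j * suc y < suc j * z → (∀ {w} → j * suc y < suc j * w → z ≤ w) → Next j y z
mkNext {j} {y} {z} lower least =
  subst (_< suc j * z) (sym (*[+1]≡*suc j y)) lower ,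
  λ w h → least (subst (_< suc j * w) (*[+1]≡*suc j y) h)

next-intro : ∀ {j y X} → suc j * X ≤ j * suc y → j * suc y < suc j * suc X → Next j y (suc X)
next-intro {j} {y} {X} lo hi =
  mkNext {j} {y} {suc X} hi λ h → ≮⇒≥ λ w<1+X → <⇒≱ h (≤-trans (*-monoʳ-≤ (suc j) (s≤s⁻¹ w<1+X)) lo)

⌊1+j*X/j⌋>X : ∀ {j X a} → ⌊ suc j * X / j ⌋≡ a → j ≤ X → X < a
⌊1+j*X/j⌋>X {j} {X} {a} (_ , hi) j≤X = ≰⇒> λ a≤X → <-irrefl refl (begin-strict
  suc j * X  <⟨ hi ⟩
  j * suc a  ≤⟨ *-monoʳ-≤ j (s≤s a≤X) ⟩
  j * suc X  ≡⟨ *-suc j X ⟩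
  j + j * X  ≤⟨ +-monoˡ-≤ (j * X) j≤X ⟩
  suc j * X  ∎)
  where open ≤-Reasoning

next-⌊/⌋ : ∀ {j X a} → ⌊ suc j * X / j ⌋≡ a → Next j a (suc X)
next-⌊/⌋ {j} {X} {a} (lo , hi) = next-intro {j} {a} {X} (<⇒≤ hi) (begin-strict
  j * suc a          ≡⟨ *-suc j a ⟩
  j + j * a          ≤⟨ +-monoʳ-≤ j lo ⟩
  j + suc j * X      <⟨ +-monoˡ-< (suc j * X) (n<1+n j) ⟩
  suc j + suc j * X  ≡⟨ *-suc (suc j) X ⟨
  suc j * suc X      ∎)
  where open ≤-Reasoning

next-exact : ∀ {j y X} → j * suc y ≡ suc j * X → Next j y (suc X)
next-exact {j} {y} {X} eq =
  next-intro {j} {y} {X} (≤-reflexive (sym eq)) (≤-<-trans (≤-reflexive eq) (*-monoʳ-< (suc j) ≤-refl))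

next-inexact : ∀ {j y X} → ⌊ suc j * X / j ⌋≡ suc y → j * suc y ≢ suc j * X → Next j y X
next-inexact {j} {y} {zero} (lo , _) ≢ =
  contradiction (≤-antisym lo (subst (_≤ j * suc y) (sym (*-zeroʳ (suc j))) z≤n)) ≢
next-inexact {j} {y} {suc X} (lo , hi) ≢ = next-intro {j} {y} {X} lo′ (≤∧≢⇒< lo ≢)
  where
  lo′ : suc j * X ≤ j * suc y
  lo′ = +-cancelˡ-≤ j _ _ (<⇒≤ (begin-strict
    j + suc j * X      <⟨ +-monoˡ-< (suc j * X) (n<1+n j) ⟩
    suc j + suc j * X  ≡⟨ *-suc (suc j) X ⟨
    suc j * suc X      <⟨ hi ⟩
    j * suc (suc y)    ≡⟨ *-suc j (suc y) ⟩
    j + j * suc y      ∎))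
    where open ≤-Reasoning

next-above : ∀ {j X a y z} → ⌊ suc j * X / j ⌋≡ a → a < y → Next j y z → suc X < z
next-above {j} {X} {a} {y} (_ , hi) a<y nx = *-cancelˡ-< (suc j) _ _ (≤-<-trans (begin
  suc j * suc X        ≡⟨ *-suc (suc j) X ⟩
  suc j + suc j * X    ≡⟨ +-suc j (suc j * X) ⟨
  j + suc (suc j * X)  ≤⟨ +-monoʳ-≤ j hi ⟩
  j + j * suc a        ≡⟨ *-suc j (suc a) ⟨
  j * suc (suc a)      ≤⟨ *-monoʳ-≤ j (s≤s a<y) ⟩
  j * suc y            ∎) (next-lower {j} {y} nx))
  where open ≤-Reasoning

next-below : ∀ {j X a y z} → ⌊ suc j * X / j ⌋≡ a → y < a → j * a ≢ suc j * X → Next j y z → z ≤ X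
next-below {j} {X} {y = y} (lo , _) y<a ≢ nx =
  next-least {j} {y} {w = X} nx (≤-<-trans (*-monoʳ-≤ j y<a) (≤∧≢⇒< lo ≢))

next-twoBelow : ∀ {j X a y z} .{{_ : NonZero j}} → ⌊ suc j * X / j ⌋≡ a → suc y < a → Next j y z → z ≤ X
next-twoBelow {j} {X} {y = y} (lo , _) 1+y<a nx =
  next-least {j} {y} {w = X} nx (<-≤-trans (*-monoʳ-< j ≤-refl) (≤-trans (*-monoʳ-≤ j 1+y<a) lo))

next₁ : ∀ {y X} → 2 * X ≡ suc (suc y) → Next 1 y X
next₁ {y} {X} eq = mkNext {1} {y} {X} lower least
  where
  lower : 1 * suc y < 2 * X
  lower = subst₂ _<_ (sym (*-identityˡ (suc y))) (sym eq) ≤-refl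
  least : ∀ {w} → 1 * suc y < 2 * w → X ≤ w
  least {w} h =
    *-cancelˡ-≤ 2 (subst (_≤ 2 * w) (sym eq) (subst (λ t → suc t ≤ 2 * w) (*-identityˡ (suc y)) h))

x-top : ∀ r → x r r ≡ r
x-top r = cong (xsFrom r) (n∸n≡0 r)

x-unfold : ∀ {r j} → j < r → x r j ≡ (suc j * (x r (suc j) ∸ 1)) div j
x-unfold {r} {j} j<r =
  trans (cong (xsFrom r) (+-∸-assoc 1 j<r)) (cong (λ i → (suc i * (x r (suc j) ∸ 1)) div i) r∸[r∸j]≡j)
  where
  r∸[r∸j]≡j : r ∸ suc (r ∸ suc j) ≡ j
  r∸[r∸j]≡j = trans (cong (r ∸_) (sym (+-∸-assoc 1 j<r))) (m∸[m∸n]≡n (<⇒≤ j<r))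

xsFrom-≥ : ∀ {r} k → k < r → r ≤ xsFrom r k
xsFrom-≥ zero _ = ≤-refl
xsFrom-≥ {r} (suc k) 1+k<r = begin
  r                            ≤⟨ ih ⟩
  xsFrom r k                   ≤⟨ m≤n+m∸n (xsFrom r k) 1 ⟩
  suc (xsFrom r k ∸ 1)         ≤⟨ ⌊1+j*X/j⌋>X (⌊/⌋≡div _ (m<n⇒0<n∸m 1+k<r)) (∸-mono ih (s≤s z≤n)) ⟩
  xsFrom r (suc k)             ∎
  where
  open ≤-Reasoning
  ih = xsFrom-≥ k (<-trans (n<1+n k) 1+k<r)

x-≥ : ∀ {r j} → 1 ≤ j → j ≤ r → r ≤ x r j
x-≥ {r} {j} 1≤j j≤r = xsFrom-≥ (r ∸ j) (∸-monoʳ-< 1≤j j≤r)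

suc[x∸1]≡x : ∀ {r j} → 1 ≤ j → j ≤ r → suc (x r j ∸ 1) ≡ x r j
suc[x∸1]≡x 1≤j j≤r = suc[m∸1]≡m (≤-trans (≤-trans 1≤j j≤r) (x-≥ 1≤j j≤r))

x-floor : ∀ {r j} → 1 ≤ j → j < r → ⌊ suc j * (x r (suc j) ∸ 1) / j ⌋≡ x r j
x-floor {r} {j} 1≤j j<r =
  subst (⌊ suc j * (x r (suc j) ∸ 1) / j ⌋≡_) (sym (x-unfold j<r)) (⌊/⌋≡div _ 1≤j)

x-penultimate : ∀ {i} → 1 ≤ i → x (suc i) i ≡ suc i
x-penultimate {i} 1≤i =
  ≤-antisym (*-cancelˡ-≤ i {{>-nonZero 1≤i}} (subst (i * x (suc i) i ≤_) eq lo)) (x-≥ 1≤i (n≤1+n i))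
  where
  lo = ⌊_/_⌋≡_.lower (x-floor {suc i} 1≤i ≤-refl)
  eq : suc i * (x (suc i) (suc i) ∸ 1) ≡ i * suc i
  eq = trans (cong (λ t → suc i * (t ∸ 1)) (x-top (suc i))) (*-comm (suc i) i)

reach-pos : ∀ {n j y} → Reach n j y → 1 ≤ j
reach-pos start = s≤s z≤n
reach-pos (step _ _ _) = s≤s z≤n

Near : ℕ → ℕ → Set
Near a y = y ≡ a ⊎ suc y ≡ a

next-near : ∀ {j X a y} → ⌊ suc j * X / j ⌋≡ a → Near a y → ∃ λ z → Next j y z × Near (suc X) z
next-near {X = X} fr (inj₁ refl) = suc X , next-⌊/⌋ fr , inj₁ refl
next-near {j} {X} {y = y} fr (inj₂ refl) with j * suc y ≟ suc j * X
... | yes exact  = suc X , next-exact {j} exact , inj₁ refl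
... | no inexact = X , next-inexact fr inexact , inj₂ refl

next-near-∣ : ∀ {j X a y} .{{_ : NonZero j}} → ⌊ suc j * X / j ⌋≡ a → j ∣ X → Near a y → Next j y (suc X)
next-near-∣ fr _ (inj₁ refl) = next-⌊/⌋ fr
next-near-∣ {j} fr j∣X (inj₂ refl) = next-exact {j} (⌊/⌋≡-exact fr (∣n⇒∣m*n (suc j) j∣X))

Near⇒≤suc : ∀ {a y} → Near a y → a ≤ suc y
Near⇒≤suc {y = y} (inj₁ refl) = n≤1+n y
Near⇒≤suc (inj₂ eq) = ≤-reflexive (sym eq)

near-x⇒> : ∀ {r j y} → 1 ≤ j → suc (suc j) ≤ r → Near (x r j) y → j < y
near-x⇒> 1≤j 2+j≤r near =
  s≤s⁻¹ (≤-trans 2+j≤r (≤-trans (x-≥ 1≤j (m+n≤o⇒n≤o 2 2+j≤r)) (Near⇒≤suc near)))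

reach-near-step : ∀ {r n j y} → 1 ≤ j → suc (suc j) ≤ r → Reach n j y → Near (x r j) y →
                  ∃ λ z → Reach n (suc j) z × Near (x r (suc j)) z
reach-near-step {r} 1≤j 2+j≤r p near =
  let z , nx , near′ = next-near (x-floor 1≤j (<⇒≤ 2+j≤r)) near
  in z , step p (near-x⇒> 1≤j 2+j≤r near) nx ,
     subst (λ a → Near a z) (suc[x∸1]≡x (s≤s z≤n) (<⇒≤ 2+j≤r)) near′

reach-near-∣ : ∀ {r n j y} → 1 ≤ j → suc (suc j) ≤ r → j ∣ x r (suc j) ∸ 1 →
               Reach n j y → Near (x r j) y → Reach n (suc j) (x r (suc j))
reach-near-∣ {r} {j = j} {y} 1≤j 2+j≤r j∣ p near =
  step p (near-x⇒> 1≤j 2+j≤r near)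
    (subst (Next j y) (suc[x∸1]≡x (s≤s z≤n) (<⇒≤ 2+j≤r))
      (next-near-∣ {{>-nonZero 1≤j}} (x-floor 1≤j (<⇒≤ 2+j≤r)) j∣ near))

reach-x-step : ∀ {r n j} → 1 ≤ j → j < r → Reach n j (x r j) → Reach n (suc j) (x r (suc j))
reach-x-step {r} {j = j} 1≤j j<r p =
  step p (<-≤-trans j<r (x-≥ 1≤j (<⇒≤ j<r)))
    (subst (Next j (x r j)) (suc[x∸1]≡x (s≤s z≤n) j<r) (next-⌊/⌋ (x-floor 1≤j j<r)))

sr-via-divisor : ∀ {r n i j y} → 1 ≤ j → j ≤ i → suc (suc i) ≤ r → i ∣ x r (suc i) ∸ 1 →
                 Reach n j y → Near (x r j) y → SR n r
sr-via-divisor {r} {n} {i} 1≤j j≤i 2+i≤r i∣ p near = x r r , reach-r , ≤-reflexive (x-top r)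
  where
  NearReach : ℕ → Set
  NearReach k = ∃ λ z → Reach n k z × Near (x r k) z
  near-i : NearReach i
  near-i = ≤-induction NearReach
    (λ j≤k k<i (z , q , near-z) →
       reach-near-step (≤-trans 1≤j j≤k) (≤-trans (s≤s (s≤s (<⇒≤ k<i))) 2+i≤r) q near-z)
    (_ , p , near) j≤i
  reach-r : Reach n r (x r r)
  reach-r = ≤-induction (λ k → Reach n k (x r k))
    (λ 1+i≤k k<r → reach-x-step (≤-trans (s≤s z≤n) 1+i≤k) k<r)
    (let z , q , near-z = near-i in reach-near-∣ (≤-trans 1≤j j≤i) 2+i≤r i∣ q near-z)
    (<⇒≤ 2+i≤r)

sr-x₁-or-pred : ∀ {r n} → 3 ≤ r → n ≡ x r 1 ⊎ n ≡ x r 1 ∸ 1 → SR n r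
sr-x₁-or-pred {r} {n} 3≤r n≈x₁ = sr-via-divisor ≤-refl ≤-refl 3≤r (1∣ _) start (near n≈x₁)
  where
  near : n ≡ x r 1 ⊎ n ≡ x r 1 ∸ 1 → Near (x r 1) n
  near (inj₁ eq) = inj₁ eq
  near (inj₂ eq) = inj₂ (trans (cong suc eq) (suc[x∸1]≡x ≤-refl (m+n≤o⇒n≤o 2 3≤r)))

sr-x₁∸2 : ∀ {r i} → 2 ≤ i → suc (suc i) ≤ r → i ∣ x r (suc i) ∸ 1 → SR (x r 1 ∸ 2) r
sr-x₁∸2 {r} 2≤i 2+i≤r i∣ =
  sr-via-divisor (s≤s z≤n) 2≤i 2+i≤r i∣ (step start 1<x₁∸2 (next₁ 2X≡2+[x₁∸2]))
    (inj₂ (suc[x∸1]≡x (s≤s z≤n) 2≤r))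
  where
  4≤r : 4 ≤ r
  4≤r = ≤-trans (s≤s (s≤s 2≤i)) 2+i≤r
  2≤r : 2 ≤ r
  2≤r = m+n≤o⇒n≤o 2 4≤r
  4≤x₁ : 4 ≤ x r 1
  4≤x₁ = ≤-trans 4≤r (x-≥ ≤-refl (m+n≤o⇒n≤o 3 4≤r))
  1<x₁∸2 : 1 < x r 1 ∸ 2
  1<x₁∸2 = ∸-monoˡ-≤ 2 4≤x₁
  x₁≡2X : x r 1 ≡ 2 * (x r 2 ∸ 1)
  x₁≡2X = trans (sym (*-identityˡ (x r 1))) (⌊/⌋≡-exact (x-floor ≤-refl 2≤r) (1∣ _))
  2X≡2+[x₁∸2] : 2 * (x r 2 ∸ 1) ≡ suc (suc (x r 1 ∸ 2))
  2X≡2+[x₁∸2] = sym (trans (+-comm 2 (x r 1 ∸ 2)) (trans (m∸n+n≡m (m+n≤o⇒n≤o 2 4≤x₁)) x₁≡2X))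

reach-above : ∀ {r n j y} → x r 1 < n → Reach n j y → j ≤ r → x r j < y
reach-above x₁<n start _ = x₁<n
reach-above {r} x₁<n (step {z = z} p _ nx) 1+i≤r =
  subst (_< z) (suc[x∸1]≡x (s≤s z≤n) 1+i≤r)
    (next-above (x-floor (reach-pos p) 1+i≤r) (reach-above x₁<n p (<⇒≤ 1+i≤r)) nx)

¬sr-above : ∀ {r n} → x r 1 < n → ¬ SR n r
¬sr-above {r} x₁<n (y , p , y≤r) = <⇒≱ (subst (_< y) (x-top r) (reach-above x₁<n p ≤-refl)) y≤r

OnlyTwoRoots : ℕ → Set
OnlyTwoRoots r = (1 ≤ x r 1 ∸ 1) × (∀ n → 1 ≤ n → (SR n r ⇔ (n ≡ x r 1 ⊎ n ≡ x r 1 ∸ 1)))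

NoDivisor : ℕ → Set
NoDivisor r = ∀ i → 2 ≤ i → i ≤ r ∸ 2 → ¬ (i ∣ x r (suc i) ∸ 1)

-- At j = 1 every step is exact (1 ∣ x₂ − 1), so the start needs a margin of two there.
reach-below : ∀ {r n j y} → NoDivisor r → suc n < x r 1 → Reach n j y → 2 ≤ j → j < r → y < x r j
reach-below _ _ start (s≤s ()) _
reach-below {r} _ 1+n<x₁ (step {z = z} start _ nx) _ 2<r =
  subst (z <_) (suc[x∸1]≡x (s≤s z≤n) (<⇒≤ 2<r))
    (s≤s (next-twoBelow (x-floor ≤-refl (m+n≤o⇒n≤o 1 2<r)) 1+n<x₁ nx))
reach-below {r} nd 1+n<x₁ (step {suc i} {z = z} p@(step q _ _) _ nx) _ 2+i<r =
  subst (z <_) (suc[x∸1]≡x (s≤s z≤n) (<⇒≤ 2+i<r))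
    (s≤s (next-below (x-floor (s≤s z≤n) (<⇒≤ 2+i<r))
                     (reach-below nd 1+n<x₁ p 2≤1+i (<⇒≤ 2+i<r)) inexact nx))
  where
  2≤1+i : 2 ≤ suc i
  2≤1+i = s≤s (reach-pos q)
  inexact : suc i * x r (suc i) ≢ suc (suc i) * (x r (suc (suc i)) ∸ 1)
  inexact eq = nd (suc i) 2≤1+i (∸-monoˡ-≤ 2 2+i<r) (*≡suc*⇒∣ eq)

¬sr-below : ∀ {r n} → 3 ≤ r → NoDivisor r → suc n < x r 1 → ¬ SR n r
¬sr-below (s≤s ()) _ _ (_ , start , _)
¬sr-below (s≤s 2≤i) nd 1+n<x₁ (_ , step {y = y} p i<y _ , _) =
  <⇒≱ i<y (s≤s⁻¹ (subst (y <_) (x-penultimate (m+n≤o⇒n≤o 1 2≤i))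
                              (reach-below nd 1+n<x₁ p 2≤i ≤-refl)))

sr⇒x₁-or-pred : ∀ {r n} → 3 ≤ r → NoDivisor r → SR n r → n ≡ x r 1 ⊎ n ≡ x r 1 ∸ 1
sr⇒x₁-or-pred 3≤r nd sr =
  n≤m≤1+n⇒n≡m⊎n≡m∸1 (≮⇒≥ λ x₁<n → ¬sr-above x₁<n sr)
                    (s≤s⁻¹ (≰⇒> λ 2+n≤x₁ → ¬sr-below 3≤r nd 2+n≤x₁ sr))

proposition4p2 : (r : ℕ) → 5 ≤ r →
    ((1 ≤ x r 1 ∸ 1) × (∀ n → 1 ≤ n → (SR n r ⇔ (n ≡ x r 1 ⊎ n ≡ x r 1 ∸ 1))))
    ⇔ (∀ i → 2 ≤ i → i ≤ r ∸ 2 → ¬ (i ∣ x r (suc i) ∸ 1))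
proposition4p2 r 5≤r = mk⇔ onlyTwo⇒noDivisor noDivisor⇒onlyTwo
  where
  3≤r : 3 ≤ r
  3≤r = m+n≤o⇒n≤o 2 5≤r
  3≤x₁ : 3 ≤ x r 1
  3≤x₁ = ≤-trans 3≤r (x-≥ ≤-refl (m+n≤o⇒n≤o 2 3≤r))
  onlyTwo⇒noDivisor : OnlyTwoRoots r → NoDivisor r
  onlyTwo⇒noDivisor (_ , onlyTwo) i 2≤i i≤r∸2 i∣ =
    m∸2≢m-or-m∸1 (m+n≤o⇒n≤o 1 3≤x₁)
      (Equivalence.to (onlyTwo (x r 1 ∸ 2) (∸-monoˡ-≤ 2 3≤x₁)) (sr-x₁∸2 2≤i 2+i≤r i∣))
    where
    2+i≤r : suc (suc i) ≤ r
    2+i≤r = subst (_≤ r) (+-comm i 2) (m≤o∸n⇒m+n≤o i (m+n≤o⇒n≤o 3 5≤r) i≤r∸2)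
  noDivisor⇒onlyTwo : NoDivisor r → OnlyTwoRoots r
  noDivisor⇒onlyTwo nd =
    ∸-monoˡ-≤ 1 (m+n≤o⇒n≤o 1 3≤x₁) , λ _ _ → mk⇔ (sr⇒x₁-or-pred 3≤r nd) (sr-x₁-or-pred 3≤r)
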